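{- Let $\mathcal{M}=(X,\leq,V)$ and $\mathcal{M}'=(X',\leq',V')$ be intuitionistic Kripke models that are both image-compact for $\mathsf{Int}$, and let $x\in X$, $x'\in X'$. Then $x$ and $x'$ are $\mathsf{Int}$-bisimilar if and only if they satisfy exactly the same $\mathsf{Int}$-formulae (i.e. for all $\phi\in\mathsf{Int}$: $\mathcal{M},x\Vdash\phi \iff \mathcal{M}',x'\Vdash\phi$).
   Context: Fix a set $\mathrm{Prop}$ of propositional variables. $\mathsf{Int}$ is the set of formulae $\phi ::= \top\mid\bot\mid p\mid \phi\wedge\phi\mid\phi\vee\phi\mid\phi\to\phi$ with $p\in\mathrm{Prop}$. An intuitionistic Kripke model is $(X,\leq,V)$ with $\leq$ a preorder (reflexive, transitive) on $X$ and $V$ assigning to each $p\in\mathrm{Prop}$ an upset of $(X,\leq)$. Truth: $x\Vdash\top$ always, $x\Vdash\bot$ never, $x\Vdash p$ iff $x\in V(p)$, $\wedge,\vee$ pointwise, $x\Vdash\phi\to\psi$ iff for all $y\geq x$, $y\Vdash\phi$ implies $y\Vdash\psi$. For upsets $a,b$ let $a\Rightarrow b=\{x\mid \forall y\geq x\,(y\in a\Rightarrow y\in b)\}$. A model is image-compact for $\mathsf{Int}$ if there exists a collection $A$ of upsets of $(X,\leq)$ containing $\emptyset$, $X$ and all $V(p)$, closed under finite unions, finite intersections and $\Rightarrow$, such that for every $x\in X$ the set ${\uparrow}x=\{y\mid x\leq y\}$ is compact in the topology $\tau_A$ generated by the subbase $A\cup\{X\setminus a\mid a\in A\}$. An $\mathsf{Int}$-bisimulation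 between $(X,\leq,V)$ and $(X',\leq',V')$ is a relation $B\subseteq X\times X'$ such that for all $(x,x')\in B$: (B1) for all $p$, $x\in V(p)$ iff $x'\in V'(p)$; (B2) if $x\leq y$ then there is $y'$ with $x'\leq' y'$ and $yBy'$; (B3) if $x'\leq' y'$ then there is $y$ with $x\leq y$ and $yBy'$. Two states are $\mathsf{Int}$-bisimilar if some $\mathsf{Int}$-bisimulation contains the pair. -}

module Defs where

open import Level using (Level; _⊔_) renaming (suc to lsuc; zero to lzero)
open import Data.Bool using (Bool; true; false)
open import Data.Product using (Σ; _×_; _,_)
open import Data.Sum using (_⊎_)
open import Data.List using (List)
open import Data.List.Relation.Unary.All using (All)
open import Data.List.Relation.Unary.Any using (Any)
open import Data.Empty using (⊥)
open import Data.Unit using (⊤)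
open import Relation.Nullary using (¬_; Dec)
open import Function.Bundles using (_⇔_)

data Form (Prop : Set) : Set where
  `⊤ `⊥ : Form Prop
  var   : Prop → Form Prop
  _∧_ _∨_ _⇒_ : Form Prop → Form Prop → Form Prop

Subset : Set → Set₁
Subset X = X → Set

record Model (Prop : Set) : Set₁ where
  field
    X      : Set
    _≤_    : X → X → Set
    ≤-refl  : ∀ {x} → x ≤ x
    ≤-trans : ∀ {x y z} → x ≤ y → y ≤ z → x ≤ z
    V      : Prop → Subset X
    V-up   : ∀ p {x y} → x ≤ y → V p x → V p y

module _ {Prop : Set} (M : Model Prop) where
  open Model M

  IsUpset : Subset X → Set
  IsUpset a = ∀ {x y} → x ≤ y → a x → a y

  ↑ : X → Subset X
  ↑ x y = x ≤ y

  _∪_ _∩_ _⇛_ : Subset X → Subset X → Subset X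
  (a ∪ b) x = a x ⊎ b x
  (a ∩ b) x = a x × b x
  (a ⇛ b) x = ∀ y → x ≤ y → a y → b y

  ∅ full : Subset X
  ∅ _ = ⊥
  full _ = ⊤

  _⊩_ : X → Form Prop → Set
  x ⊩ `⊤ = ⊤
  x ⊩ `⊥ = ⊥
  x ⊩ var p = V p x
  x ⊩ (φ ∧ ψ) = (x ⊩ φ) × (x ⊩ ψ)
  x ⊩ (φ ∨ ψ) = (x ⊩ φ) ⊎ (x ⊩ ψ)
  x ⊩ (φ ⇒ ψ) = ∀ y → x ≤ y → y ⊩ φ → y ⊩ ψ

  record IsIntAlgebra (A : Subset X → Set) : Set₁ where
    field
      upsets : ∀ a → A a → IsUpset a
      has-∅  : A ∅
      has-X  : A full
      has-V  : ∀ p → A (V p)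
      ∪-closed : ∀ a b → A a → A b → A (a ∪ b)
      ∩-closed : ∀ a b → A a → A b → A (a ∩ b)
      ⇛-closed : ∀ a b → A a → A b → A (a ⇛ b)

  -- Topology τ_A generated by the subbase A ∪ {X \ a | a ∈ A}.
  -- A subbase element is a member a of A together with a flag:
  -- true = a itself, false = its complement X \ a.
  SubbaseElt : (Subset X → Set) → Set₁
  SubbaseElt A = Σ (Subset X) λ a → A a × Bool

  ⟦_⟧ˢ : ∀ {A} → SubbaseElt A → Subset X
  ⟦ (a , _ , true) ⟧ˢ x = a x
  ⟦ (a , _ , false) ⟧ˢ x = ¬ a x

  -- U is open iff it is a union of finite intersections of subbase
  -- elements, i.e. every point of U lies in a finite intersection of
  -- subbase elements contained in U.
  IsOpen : (Subset X → Set) → Subset X → Set₁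
  IsOpen A U = ∀ x → U x →
    Σ (List (SubbaseElt A)) λ l →
      All (λ s → ⟦ s ⟧ˢ x) l × (∀ y → All (λ s → ⟦ s ⟧ˢ y) l → U y)

  IsCompact : (Subset X → Set) → Subset X → Set₂
  IsCompact A K = ∀ (I : Set₁) (U : I → Subset X) →
    (∀ i → IsOpen A (U i)) →
    (∀ k → K k → Σ I λ i → U i k) →
    Σ (List I) λ is → ∀ k → K k → Any (λ i → U i k) is

  ImageCompact : Set₂
  ImageCompact = Σ (Subset X → Set) λ A →
    IsIntAlgebra A × (∀ x → IsCompact A (↑ x))

module _ {Prop : Set} (M M' : Model Prop) where
  private
    module M  = Model M
    module M' = Model M'

  record IsBisimulation (B : M.X → M'.X → Set) : Set where
    field
      B1 : ∀ {x x'} → B x x' → ∀ p → (M.V p x → M'.V p x') × (M'.V p x' → M.V p x)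
      B2 : ∀ {x x'} → B x x' → ∀ y → x M.≤ y → Σ M'.X λ y' → (x' M'.≤ y') × B y y'
      B3 : ∀ {x x'} → B x x' → ∀ y' → x' M'.≤ y' → Σ M.X λ y → (x M.≤ y) × B y y'

  Bisimilar : M.X → M'.X → Set₁
  Bisimilar x x' = Σ (M.X → M'.X → Set) λ B → IsBisimulation B × B x x'

  ModallyEquivalent : M.X → M'.X → Set
  ModallyEquivalent x x' = ∀ φ → (_⊩_ M x φ → _⊩_ M' x' φ) × (_⊩_ M' x' φ → _⊩_ M x φ)

-- Excluded middle (the paper's metatheory is classical)
LEM : Set₁
LEM = (P : Set) → Dec P

-- Truth of formulas is invariant under bisimulation, by induction on the formula.
-- Conversely, modal equivalence is itself a bisimulation. For the back-and-forth
-- condition, suppose x ≤ y but no successor of x' is equivalent to y. Then every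
-- w ≥ x' is separated from y by a formula, true at one and false at the other, and
-- the set of points where such a formula disagrees with y is a subbasic open of τ_A.
-- By compactness of ↑x' finitely many of them cover ↑x', so x' forces ⋀Φ ⇒ ⋁Ψ,
-- where Φ are the chosen formulas true at y and Ψ those false at y. By equivalence
-- x forces it too, which fails at y.
module Submission where

open import Defs
open import Function.Base using (_∘_)
open import Function.Bundles using (_⇔_; mk⇔)
open import Level using (Lift; lift; lower) renaming (suc to lsuc)
open import Data.Bool using (true; false)
open import Data.Product using (Σ; _×_; _,_; proj₁; proj₂)
open import Data.Sum using (_⊎_; inj₁; inj₂)
open import Data.List using (List; []; _∷_; map)
open import Data.List.Relation.Unary.All using ([]; _∷_)
open import Data.List.Relation.Unary.Any using (Any; here; there)
open import Data.List.Relation.Unary.Any.Properties using (map⁺)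
open import Data.Empty using (⊥-elim)
open import Data.Unit using (tt)
open import Relation.Nullary using (¬_)
open import Relation.Nullary.Decidable.Core using (decidable-stable)

lem-stable : LEM → {P : Set} → ¬ ¬ P → P
lem-stable lem {P} = decidable-stable (lem P)

module _ {Prop : Set} (M : Model Prop) where
  open Model M

  ⊩-∈-algebra : ∀ {A} → IsIntAlgebra M A → ∀ φ → A (λ w → _⊩_ M w φ)
  ⊩-∈-algebra alg `⊤ = IsIntAlgebra.has-X alg
  ⊩-∈-algebra alg `⊥ = IsIntAlgebra.has-∅ alg
  ⊩-∈-algebra alg (var p) = IsIntAlgebra.has-V alg p
  ⊩-∈-algebra alg (φ ∧ ψ) = IsIntAlgebra.∩-closed alg _ _ (⊩-∈-algebra alg φ) (⊩-∈-algebra alg ψ)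
  ⊩-∈-algebra alg (φ ∨ ψ) = IsIntAlgebra.∪-closed alg _ _ (⊩-∈-algebra alg φ) (⊩-∈-algebra alg ψ)
  ⊩-∈-algebra alg (φ ⇒ ψ) = IsIntAlgebra.⇛-closed alg _ _ (⊩-∈-algebra alg φ) (⊩-∈-algebra alg ψ)

  subbase-open : ∀ {A} (s : SubbaseElt M A) → IsOpen M A (⟦_⟧ˢ M s)
  subbase-open s x sx = s ∷ [] , sx ∷ [] , λ { y (sy ∷ []) → sy }

module _ {Prop : Set} (M M' : Model Prop) where
  private
    module M  = Model M
    module M' = Model M'

    _⊩₁_ = _⊩_ M
    _⊩₂_ = _⊩_ M'

  equivalent-sym : ∀ {x x'} → ModallyEquivalent M M' x x' → ModallyEquivalent M' M x' x
  equivalent-sym eq φ = proj₂ (eq φ) , proj₁ (eq φ)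

  bisimulation⇒equivalent : ∀ {B} → IsBisimulation M M' B →
                            ∀ {x x'} → B x x' → ModallyEquivalent M M' x x'
  bisimulation⇒equivalent {B} isB = preserve
    where
    open IsBisimulation isB
    preserve : ∀ {x x'} → B x x' → ModallyEquivalent M M' x x'
    preserve b `⊤ = (λ _ → tt) , (λ _ → tt)
    preserve b `⊥ = (λ ()) , (λ ())
    preserve b (var p) = B1 b p
    preserve b (φ ∧ ψ) =
        (λ { (u , v) → proj₁ (preserve b φ) u , proj₁ (preserve b ψ) v })
      , (λ { (u , v) → proj₂ (preserve b φ) u , proj₂ (preserve b ψ) v })
    preserve b (φ ∨ ψ) =
        (λ { (inj₁ u) → inj₁ (proj₁ (preserve b φ) u) ; (inj₂ v) → inj₂ (proj₁ (preserve b ψ) v) })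
      , (λ { (inj₁ u) → inj₁ (proj₂ (preserve b φ) u) ; (inj₂ v) → inj₂ (proj₂ (preserve b ψ) v) })
    preserve b (φ ⇒ ψ) =
        (λ h y' x'≤y' u → let (y , x≤y , b') = B3 b y' x'≤y'
                          in proj₁ (preserve b' ψ) (h y x≤y (proj₂ (preserve b' φ) u)))
      , (λ h y x≤y u → let (y' , x'≤y' , b') = B2 b y x≤y
                       in proj₂ (preserve b' ψ) (h y' x'≤y' (proj₁ (preserve b' φ) u)))

  Test : M.X → Set
  Test y = Σ (Form Prop) (λ φ → ¬ y ⊩₁ φ) ⊎ Σ (Form Prop) (λ φ → y ⊩₁ φ)

  Disagrees : ∀ {y} → Test y → Subset M'.X
  Disagrees (inj₁ (φ , _)) w = w ⊩₂ φ
  Disagrees (inj₂ (φ , _)) w = ¬ w ⊩₂ φ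

  disagreement-open : ∀ {A} → IsIntAlgebra M' A → ∀ {y} (t : Test y) → IsOpen M' A (Disagrees t)
  disagreement-open alg (inj₁ (φ , _)) = subbase-open M' (_ , ⊩-∈-algebra M' alg φ , true)
  disagreement-open alg (inj₂ (φ , _)) = subbase-open M' (_ , ⊩-∈-algebra M' alg φ , false)

  separating-test : LEM → ∀ {y w} → ¬ ModallyEquivalent M M' y w → Σ (Test y) (λ t → Disagrees t w)
  separating-test lem ¬eq = lem-stable lem λ ¬sep → ¬eq λ φ →
      (λ yφ → lem-stable lem λ ¬wφ → ¬sep (inj₂ (φ , yφ) , ¬wφ))
    , (λ wφ → lem-stable lem λ ¬yφ → ¬sep (inj₁ (φ , ¬yφ) , wφ))

  ⋀true ⋁false : ∀ {y} → List (Test y) → Form Prop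
  ⋀true [] = `⊤
  ⋀true (inj₁ _ ∷ ts) = ⋀true ts
  ⋀true (inj₂ (φ , _) ∷ ts) = φ ∧ ⋀true ts
  ⋁false [] = `⊥
  ⋁false (inj₁ (φ , _) ∷ ts) = φ ∨ ⋁false ts
  ⋁false (inj₂ _ ∷ ts) = ⋁false ts

  ⋀true-holds : ∀ {y} (ts : List (Test y)) → y ⊩₁ ⋀true ts
  ⋀true-holds [] = tt
  ⋀true-holds (inj₁ _ ∷ ts) = ⋀true-holds ts
  ⋀true-holds (inj₂ (_ , yφ) ∷ ts) = yφ , ⋀true-holds ts

  ⋁false-fails : ∀ {y} (ts : List (Test y)) → ¬ y ⊩₁ ⋁false ts
  ⋁false-fails [] ()
  ⋁false-fails (inj₁ (_ , ¬yφ) ∷ ts) (inj₁ yφ) = ¬yφ yφ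
  ⋁false-fails (inj₁ _ ∷ ts) (inj₂ yΨ) = ⋁false-fails ts yΨ
  ⋁false-fails (inj₂ _ ∷ ts) yΨ = ⋁false-fails ts yΨ

  disagreement-forces-⋀⇒⋁ : ∀ {y} (ts : List (Test y)) {w} → Any (λ t → Disagrees t w) ts →
                            w ⊩₂ ⋀true ts → w ⊩₂ ⋁false ts
  disagreement-forces-⋀⇒⋁ (inj₁ _ ∷ ts) (here wφ) _ = inj₁ wφ
  disagreement-forces-⋀⇒⋁ (inj₂ _ ∷ ts) (here ¬wφ) (wφ , _) = ⊥-elim (¬wφ wφ)
  disagreement-forces-⋀⇒⋁ (inj₁ _ ∷ ts) (there d) wΦ = inj₂ (disagreement-forces-⋀⇒⋁ ts d wΦ)
  disagreement-forces-⋀⇒⋁ (inj₂ _ ∷ ts) (there d) (_ , wΦ) = disagreement-forces-⋀⇒⋁ ts d wΦ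

  equivalent-zig : LEM → ImageCompact M' → ∀ {x x'} → ModallyEquivalent M M' x x' →
                   ∀ y → x M.≤ y → Σ M'.X (λ y' → (x' M'.≤ y') × ModallyEquivalent M M' y y')
  equivalent-zig lem (A , alg , compact) {x} {x'} eq y x≤y = lem-stable lem λ none →
    let separated : ∀ w → x' M'.≤ w → Σ (Lift (lsuc _) (Test y)) (λ t → Disagrees (lower t) w)
        separated w x'≤w = let (t , d) = separating-test lem (λ e → none (w , x'≤w , e)) in lift t , d
        (cover , covers) = compact x' _ (Disagrees ∘ lower) (disagreement-open alg ∘ lower) separated
        ts = map lower cover
        x'⊩ : x' ⊩₂ (⋀true ts ⇒ ⋁false ts)
        x'⊩ w x'≤w = disagreement-forces-⋀⇒⋁ ts (map⁺ (covers w x'≤w))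
    in ⋁false-fails ts (proj₂ (eq (⋀true ts ⇒ ⋁false ts)) x'⊩ y x≤y (⋀true-holds ts))

equivalence-bisimulation : LEM → {Prop : Set} (M M' : Model Prop) →
                           ImageCompact M → ImageCompact M' →
                           IsBisimulation M M' (ModallyEquivalent M M')
IsBisimulation.B1 (equivalence-bisimulation lem M M' icM icM') eq p = eq (var p)
IsBisimulation.B2 (equivalence-bisimulation lem M M' icM icM') =
  equivalent-zig M M' lem icM'
IsBisimulation.B3 (equivalence-bisimulation lem M M' icM icM') eq y' x'≤y' =
  let (y , x≤y , eq') = equivalent-zig M' M lem icM (equivalent-sym M M' eq) y' x'≤y'
  in y , x≤y , equivalent-sym M' M eq'

theorem4p3 : LEM → {Prop : Set} (M M' : Model Prop) →
    ImageCompact M → ImageCompact M' →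
    (x : Model.X M) (x' : Model.X M') →
    Bisimilar M M' x x' ⇔ ModallyEquivalent M M' x x'
theorem4p3 lem M M' icM icM' x x' = mk⇔
  (λ (B , isB , b) → bisimulation⇒equivalent M M' isB b)
  (λ eq → ModallyEquivalent M M' , equivalence-bisimulation lem M M' icM icM' , eq)
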